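{- For any integers $m,t\ge 0$ with $t\le\binom{m+1}{2}$, $$\sum_{\substack{\lambda\subseteq[m]\\|\lambda|=t}} g^{\lambda}g^{\lambda^c}=g^{[m]},$$ where the sum runs over strict partitions $\lambda$ of size $t$ all of whose parts lie in $\{1,\ldots,m\}$, and $\lambda^c$ is the strict partition whose set of parts is the complement in $\{1,\ldots,m\}$ of the set of parts of $\lambda$. In particular the left-hand side is independent of $t$.
   Context: For a strict partition $\lambda=(\lambda_1>\cdots>\lambda_\ell>0)$ the shifted diagram consists of cells $(i,j)$, $1\le i\le\ell$, $i\le j\le\lambda_i+i-1$; $g^\lambda$ is the number of fillings of it by $1,\ldots,|\lambda|$ increasing along rows and down columns (shifted SYT), with $g^\emptyset=1$. $[m]=(m,m-1,\ldots,1)$. -}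

module Defs where

open import Data.Bool using (Bool; true; false; _∧_; _∨_; not; if_then_else_)
open import Data.Nat using (ℕ; zero; suc; _+_; _*_; _≡ᵇ_; _<ᵇ_)
open import Data.List using (List; []; _∷_; _++_; length; filter; map; concatMap; zip; downFrom; upTo)
open import Data.Nat.ListAction using (sum)
open import Data.Bool.ListAction using (all; any)
open import Data.Product using (_×_; _,_)
open import Function using (_∘_)
open import Relation.Nullary.Decidable using (T?)

-- A strict partition is represented by its list of parts in decreasing
-- order (λ₁ > λ₂ > … > λℓ > 0).

-- [m] = (m, m-1, …, 1)
stair : ℕ → List ℕ
stair m = map suc (downFrom m)

sublists : List ℕ → List (List ℕ)
sublists [] = [] ∷ []
sublists (x ∷ xs) = map (x ∷_) (sublists xs) ++ sublists xs

elemᵇ : ℕ → List ℕ → Bool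
elemᵇ x ys = any (x ≡ᵇ_) ys

compl : ℕ → List ℕ → List ℕ
compl m lam = filter (λ x → T? (not (elemᵇ x lam))) (stair m)

-- cells of the shifted diagram: row i (1-based), columns i … λ_i + i - 1
cellsFrom : ℕ → List ℕ → List (ℕ × ℕ)
cellsFrom i [] = []
cellsFrom i (p ∷ ps) = map (λ k → (i , i + k)) (upTo p) ++ cellsFrom (suc i) ps

cells : List ℕ → List (ℕ × ℕ)
cells = cellsFrom 1

allLists : ℕ → ℕ → List (List ℕ)
allLists n zero = [] ∷ []
allLists n (suc N) = concatMap (λ v → map (v ∷_) (allLists n N)) (map suc (upTo n))

distinctᵇ : List ℕ → Bool
distinctᵇ [] = true
distinctᵇ (x ∷ xs) = not (elemᵇ x xs) ∧ distinctᵇ xs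

adjᵇ : ℕ × ℕ → ℕ × ℕ → Bool
adjᵇ (i , j) (i' , j') = ((i' ≡ᵇ i) ∧ (j' ≡ᵇ suc j)) ∨ ((i' ≡ᵇ suc i) ∧ (j' ≡ᵇ j))

increasingᵇ : List ((ℕ × ℕ) × ℕ) → Bool
increasingᵇ cf = all (λ { (c , a) → all (λ { (d , b) → not (adjᵇ c d) ∨ (a <ᵇ b) }) cf }) cf

-- a filling (values listed in the order of `cells lam`) is a shifted SYT:
-- entries are exactly 1,…,|λ| (distinct, in range, |λ| many) and increase
-- along rows and columns
isShiftedSYTᵇ : List ℕ → List ℕ → Bool
isShiftedSYTᵇ lam vals = distinctᵇ vals ∧ increasingᵇ (zip (cells lam) vals)

g : List ℕ → ℕ
g lam = length (filter (λ vs → T? (isShiftedSYTᵇ lam vs))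
                       (allLists (sum lam) (length (cells lam))))

lhs : ℕ → ℕ → List ℕ
lhs m t = map (λ lam → if sum lam ≡ᵇ t then g lam * g (compl m lam) else 0)
              (sublists (stair m))

-- Encode λ ⊆ [m] by its characteristic bit vector, so that λ ↦ λᶜ is bitwise negation.
-- The largest entry of a shifted standard tableau sits in a corner, whence g^λ = Σ g^μ over
-- the shapes μ ⋖ λ obtained from λ by removing a corner. In bit vectors, removing a corner turns
-- a pattern 10 into 01 (or a final 1 into 0), so μ arises from λ in this way exactly when λᶜ
-- arises from μᶜ. Writing S_t for the sum over |λ| = t, this gives
--   S_{t+1} = Σ_{|λ| = t+1} Σ_{μ ⋖ λ} g^μ g^{λᶜ} = Σ_{|μ| = t} g^μ Σ_{ν ⋖ μᶜ} g^ν = S_t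
-- as long as t < |[m]|, hence S_t = S_0 = g^∅ g^{[m]}.

module Submission where

open import Defs
open import Algebra.Bundles using (CommutativeMonoid)
import Algebra.Properties.CommutativeSemigroup as CommutativeSemigroupProperties
open import Data.Bool using (Bool; true; false; _∧_; _∨_; not; if_then_else_; T)
open import Data.Bool.ListAction using (all)
open import Data.Bool.Properties
  using (∧-zeroʳ; ∨-identityʳ; ∨-zeroʳ; ∧-assoc; ∧-conicalˡ; ∧-conicalʳ; ∨-conicalˡ; ∨-conicalʳ; not-involutive;
         ∧-commutativeMonoid; ∨-commutativeMonoid)
open import Data.Empty using (⊥-elim)
open import Data.List using (List; []; _∷_; _++_; length; filter; map; concatMap; zip; foldr; upTo; applyUpTo; replicate)
open import Data.List.Properties
  using (map-++; length-++; map-∘; map-cong; map-cong-local; length-replicate; upTo-∷ʳ; map-upTo; length-map; length-applyUpTo)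
open import Data.List.Relation.Unary.All as All using (All; []; _∷_)
open import Data.List.Relation.Unary.All.Properties using (++⁺; map⁺; applyUpTo⁺₁)
open import Data.Nat using (ℕ; zero; suc; pred; _+_; _*_; _≤_; _<_; >-nonZero; z≤n; s≤s; z<s; s<s; _≡ᵇ_; _<ᵇ_)
open import Data.Nat.Combinatorics using (_C_; nC1≡n; nCk+nC[k+1]≡[n+1]C[k+1])
open import Data.Nat.ListAction using (sum)
open import Data.Nat.ListAction.Properties using (sum-++)
open import Data.Nat.Properties
open import Algebra.Properties.CommutativeSemigroup +-commutativeSemigroup using (interchange; x∙yz≈y∙xz)
open import Data.Product using (_×_; _,_; proj₁; proj₂)
open import Data.Unit using (tt)
open import Function using (_∘_; id)
open import Relation.Binary.PropositionalEquality
open import Relation.Nullary.Decidable using (T?)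

module ∧ = CommutativeSemigroupProperties (CommutativeMonoid.commutativeSemigroup ∧-commutativeMonoid)
module ∨ = CommutativeSemigroupProperties (CommutativeMonoid.commutativeSemigroup ∨-commutativeMonoid)

private
  variable
    A B : Set

𝟙 : Bool → ℕ
𝟙 true = 1
𝟙 false = 0

𝟙-∧ : ∀ a b → 𝟙 (a ∧ b) ≡ 𝟙 a * 𝟙 b
𝟙-∧ true b = sym (+-identityʳ (𝟙 b))
𝟙-∧ false b = refl

if-then-0≡𝟙* : ∀ b x → (if b then x else 0) ≡ 𝟙 b * x
if-then-0≡𝟙* true x = sym (*-identityˡ x)
if-then-0≡𝟙* false x = refl

length-filterᵇ : ∀ (p : A → Bool) xs → length (filter (T? ∘ p) xs) ≡ sum (map (𝟙 ∘ p) xs)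
length-filterᵇ p [] = refl
length-filterᵇ p (x ∷ xs) with p x
... | true = cong suc (length-filterᵇ p xs)
... | false = length-filterᵇ p xs

≡ᵇ-refl : ∀ n → (n ≡ᵇ n) ≡ true
≡ᵇ-refl zero = refl
≡ᵇ-refl (suc n) = ≡ᵇ-refl n

≡ᵇ-true⇒≡ : ∀ m n → (m ≡ᵇ n) ≡ true → m ≡ n
≡ᵇ-true⇒≡ m n e = ≡ᵇ⇒≡ m n (subst T (sym e) tt)

≢⇒≡ᵇ-false : ∀ m n → m ≢ n → (m ≡ᵇ n) ≡ false
≢⇒≡ᵇ-false m n m≢n with m ≡ᵇ n in e
... | false = refl
... | true = ⊥-elim (m≢n (≡ᵇ-true⇒≡ m n e))

≡ᵇ-false⇒≢ : ∀ {m n} → (m ≡ᵇ n) ≡ false → m ≢ n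
≡ᵇ-false⇒≢ {m} e refl with trans (sym (≡ᵇ-refl m)) e
... | ()

≡ᵇ-sym : ∀ m n → (m ≡ᵇ n) ≡ (n ≡ᵇ m)
≡ᵇ-sym zero zero = refl
≡ᵇ-sym zero (suc n) = refl
≡ᵇ-sym (suc m) zero = refl
≡ᵇ-sym (suc m) (suc n) = ≡ᵇ-sym m n

≤⇒<ᵇ-false : ∀ {m n} → n ≤ m → (m <ᵇ n) ≡ false
≤⇒<ᵇ-false {m} {n} n≤m with m <ᵇ n in e
... | false = refl
... | true = ⊥-elim (<⇒≱ (<ᵇ⇒< m n (subst T (sym e) tt)) n≤m)

<⇒<ᵇ-true : ∀ {m n} → m < n → (m <ᵇ n) ≡ true
<⇒<ᵇ-true {m} {n} m<n with m <ᵇ n | <⇒<ᵇ m<n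
... | true | _ = refl

sum-map-++ : ∀ (f : A → ℕ) xs ys → sum (map f (xs ++ ys)) ≡ sum (map f xs) + sum (map f ys)
sum-map-++ f xs ys = trans (cong sum (map-++ f xs ys)) (sum-++ (map f xs) (map f ys))

sum-map-∘ : ∀ (f : B → ℕ) (h : A → B) xs → sum (map f (map h xs)) ≡ sum (map (f ∘ h) xs)
sum-map-∘ f h xs = cong sum (sym (map-∘ xs))

sum-map-cong : ∀ {f h : A → ℕ} → (∀ x → f x ≡ h x) → ∀ xs → sum (map f xs) ≡ sum (map h xs)
sum-map-cong f≗h xs = cong sum (map-cong f≗h xs)

sum-map-cong-local : ∀ {f h : A → ℕ} {xs} → All (λ x → f x ≡ h x) xs → sum (map f xs) ≡ sum (map h xs)
sum-map-cong-local eqs = cong sum (map-cong-local eqs)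

sum-map-concatMap : ∀ (f : B → ℕ) (h : A → List B) xs →
  sum (map f (concatMap h xs)) ≡ sum (map (λ x → sum (map f (h x))) xs)
sum-map-concatMap f h [] = refl
sum-map-concatMap f h (x ∷ xs) =
  trans (sum-map-++ f (h x) (concatMap h xs)) (cong (sum (map f (h x)) +_) (sum-map-concatMap f h xs))

sum-map-+ : ∀ (f h : A → ℕ) xs → sum (map (λ x → f x + h x) xs) ≡ sum (map f xs) + sum (map h xs)
sum-map-+ f h [] = refl
sum-map-+ f h (x ∷ xs) = trans (cong (f x + h x +_) (sum-map-+ f h xs)) (interchange (f x) (h x) _ _)

sum-map-*ˡ : ∀ c (f : A → ℕ) xs → sum (map (λ x → c * f x) xs) ≡ c * sum (map f xs)
sum-map-*ˡ c f [] = sym (*-zeroʳ c)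
sum-map-*ˡ c f (x ∷ xs) = trans (cong (c * f x +_) (sum-map-*ˡ c f xs)) (sym (*-distribˡ-+ c (f x) _))

sum-map-*ʳ : ∀ c (f : A → ℕ) xs → sum (map (λ x → f x * c) xs) ≡ sum (map f xs) * c
sum-map-*ʳ c f [] = refl
sum-map-*ʳ c f (x ∷ xs) = trans (cong (f x * c +_) (sum-map-*ʳ c f xs)) (sym (*-distribʳ-+ c (f x) _))

sum-map-zero : ∀ (xs : List A) → sum (map (λ _ → 0) xs) ≡ 0
sum-map-zero [] = refl
sum-map-zero (x ∷ xs) = sum-map-zero xs

Σ< : ℕ → (ℕ → ℕ) → ℕ
Σ< zero f = 0
Σ< (suc n) f = f 0 + Σ< n (f ∘ suc)

Σ<-cong : ∀ n {f h : ℕ → ℕ} → (∀ k → k < n → f k ≡ h k) → Σ< n f ≡ Σ< n h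
Σ<-cong zero eq = refl
Σ<-cong (suc n) eq = cong₂ _+_ (eq 0 z<s) (Σ<-cong n (λ k k<n → eq (suc k) (s<s k<n)))

Σ<-zero : ∀ n → Σ< n (λ _ → 0) ≡ 0
Σ<-zero zero = refl
Σ<-zero (suc n) = Σ<-zero n

Σ<-+ : ∀ m n f → Σ< (m + n) f ≡ Σ< m f + Σ< n (λ k → f (m + k))
Σ<-+ zero n f = refl
Σ<-+ (suc m) n f = trans (cong (f 0 +_) (Σ<-+ m n (f ∘ suc))) (sym (+-assoc (f 0) _ _))

Σ<-suc : ∀ n f → Σ< (suc n) f ≡ Σ< n f + f n
Σ<-suc n f = begin
  Σ< (suc n) f               ≡⟨ cong (λ k → Σ< k f) (+-comm 1 n) ⟩
  Σ< (n + 1) f               ≡⟨ Σ<-+ n 1 f ⟩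
  Σ< n f + (f (n + 0) + 0)   ≡⟨ cong (Σ< n f +_) (trans (+-identityʳ _) (cong f (+-identityʳ n))) ⟩
  Σ< n f + f n               ∎
  where open ≡-Reasoning

Σ<-*ʳ : ∀ n (f : ℕ → ℕ) c → Σ< n (λ k → f k * c) ≡ Σ< n f * c
Σ<-*ʳ zero f c = refl
Σ<-*ʳ (suc n) f c = trans (cong (f 0 * c +_) (Σ<-*ʳ n (f ∘ suc) c)) (sym (*-distribʳ-+ c (f 0) _))

sum-map-Σ< : ∀ n (f : ℕ → A → ℕ) xs → sum (map (λ x → Σ< n (λ k → f k x)) xs) ≡ Σ< n (λ k → sum (map (f k) xs))
sum-map-Σ< zero f xs = sum-map-zero xs
sum-map-Σ< (suc n) f xs = trans (sum-map-+ (f 0) _ xs) (cong (sum (map (f 0) xs) +_) (sum-map-Σ< n (f ∘ suc) xs))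

InRange : ℕ → ℕ → Set
InRange n x = 1 ≤ x × x ≤ n

values : ℕ → List ℕ
values n = map suc (upTo n)

values-inRange : ∀ n → All (InRange n) (values n)
values-inRange n = map⁺ (applyUpTo⁺₁ id n (λ k<n → s≤s z≤n , k<n))

values-suc : ∀ n → values (suc n) ≡ values n ++ suc n ∷ []
values-suc n = trans (cong (map suc) (sym (upTo-∷ʳ n))) (map-++ suc (upTo n) (n ∷ []))

sumLists : ℕ → ℕ → (List ℕ → ℕ) → ℕ
sumLists n N f = sum (map f (allLists n N))

sumLists-suc : ∀ n N f → sumLists n (suc N) f ≡ sum (map (λ v → sumLists n N (f ∘ (v ∷_))) (values n))
sumLists-suc n N f = trans (sum-map-concatMap f (λ v → map (v ∷_) (allLists n N)) (values n))
  (sum-map-cong (λ v → sum-map-∘ f (v ∷_) (allLists n N)) (values n))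

sumLists-cong-local : ∀ n N {f h : List ℕ → ℕ} →
  (∀ vs → length vs ≡ N → All (InRange n) vs → f vs ≡ h vs) → sumLists n N f ≡ sumLists n N h
sumLists-cong-local n zero eq = cong (_+ 0) (eq [] refl [])
sumLists-cong-local n (suc N) {f} {h} eq = begin
  sumLists n (suc N) f                                     ≡⟨ sumLists-suc n N f ⟩
  sum (map (λ v → sumLists n N (f ∘ (v ∷_))) (values n))   ≡⟨ sum-map-cong-local (All.map recurse (values-inRange n)) ⟩
  sum (map (λ v → sumLists n N (h ∘ (v ∷_))) (values n))   ≡⟨ sumLists-suc n N h ⟨
  sumLists n (suc N) h                                     ∎
  where
  open ≡-Reasoning
  recurse : ∀ {v} → InRange n v → sumLists n N (f ∘ (v ∷_)) ≡ sumLists n N (h ∘ (v ∷_))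
  recurse {v} v∈ = sumLists-cong-local n N (λ ws len ws∈ → eq (v ∷ ws) (cong suc len) (v∈ ∷ ws∈))

sumLists-*ˡ : ∀ n N c f → sumLists n N (λ vs → c * f vs) ≡ c * sumLists n N f
sumLists-*ˡ n N c f = sum-map-*ˡ c f (allLists n N)

inRange⇒≢ᵇ-suc : ∀ {n v} → InRange n v → (suc n ≡ᵇ v) ≡ false
inRange⇒≢ᵇ-suc {n} (_ , v≤n) = ≢⇒≡ᵇ-false _ _ (λ e → 1+n≰n (subst (_≤ n) (sym e) v≤n))

sum-values-at-max : ∀ n (h : ℕ → ℕ) → sum (map (λ v → 𝟙 (suc n ≡ᵇ v) * h v) (values (suc n))) ≡ h (suc n)
sum-values-at-max n h = begin
  sum (map F (values (suc n)))                  ≡⟨ cong (sum ∘ map F) (values-suc n) ⟩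
  sum (map F (values n ++ suc n ∷ []))          ≡⟨ sum-map-++ F (values n) _ ⟩
  sum (map F (values n)) + (F (suc n) + 0)      ≡⟨ cong₂ _+_ below-max (+-identityʳ _) ⟩
  F (suc n)                                     ≡⟨ cong (λ b → 𝟙 b * h (suc n)) (≡ᵇ-refl n) ⟩
  1 * h (suc n)                                 ≡⟨ *-identityˡ _ ⟩
  h (suc n)                                     ∎
  where
  open ≡-Reasoning
  F : ℕ → ℕ
  F v = 𝟙 (suc n ≡ᵇ v) * h v
  below-max : sum (map F (values n)) ≡ 0
  below-max = trans (sum-map-cong-local (All.map (λ {v} v∈ → cong (λ b → 𝟙 b * h v) (inRange⇒≢ᵇ-suc v∈))
                (values-inRange n)))
              (sum-map-zero (values n))

sum-values-below-max : ∀ n (h : ℕ → ℕ) →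
  sum (map (λ v → 𝟙 (not (suc n ≡ᵇ v)) * h v) (values (suc n))) ≡ sum (map h (values n))
sum-values-below-max n h = begin
  sum (map F (values (suc n)))                  ≡⟨ cong (sum ∘ map F) (values-suc n) ⟩
  sum (map F (values n ++ suc n ∷ []))          ≡⟨ sum-map-++ F (values n) _ ⟩
  sum (map F (values n)) + (F (suc n) + 0)      ≡⟨ cong₂ _+_ below-max (cong (λ b → 𝟙 (not b) * h (suc n) + 0) (≡ᵇ-refl n)) ⟩
  sum (map h (values n)) + 0                    ≡⟨ +-identityʳ _ ⟩
  sum (map h (values n))                        ∎
  where
  open ≡-Reasoning
  F : ℕ → ℕ
  F v = 𝟙 (not (suc n ≡ᵇ v)) * h v
  below-max : sum (map F (values n)) ≡ sum (map h (values n))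
  below-max = sum-map-cong-local (All.map (λ {v} v∈ → trans (cong (λ b → 𝟙 (not b) * h v) (inRange⇒≢ᵇ-suc v∈))
                (*-identityˡ (h v))) (values-inRange n))

nth : A → List A → ℕ → A
nth d [] _ = d
nth d (x ∷ xs) zero = x
nth d (x ∷ xs) (suc k) = nth d xs k

deleteNth : ℕ → List A → List A
deleteNth _ [] = []
deleteNth zero (x ∷ xs) = xs
deleteNth (suc k) (x ∷ xs) = x ∷ deleteNth k xs

insertNth : ℕ → A → List A → List A
insertNth zero y xs = y ∷ xs
insertNth (suc k) y [] = y ∷ []
insertNth (suc k) y (x ∷ xs) = x ∷ insertNth k y xs

length-deleteNth : ∀ k (xs : List A) → k < length xs → suc (length (deleteNth k xs)) ≡ length xs
length-deleteNth zero (x ∷ xs) _ = refl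
length-deleteNth (suc k) (x ∷ xs) (s<s k<n) = cong suc (length-deleteNth k xs k<n)

sumLists-nth-max : ∀ n k N f → k ≤ N →
  sumLists (suc n) (suc N) (λ vs → 𝟙 (suc n ≡ᵇ nth 0 vs k) * f vs) ≡ sumLists (suc n) N (f ∘ insertNth k (suc n))
sumLists-nth-max n zero N f _ = begin
  sumLists (suc n) (suc N) (λ vs → 𝟙 (suc n ≡ᵇ nth 0 vs 0) * f vs)
    ≡⟨ sumLists-suc (suc n) N _ ⟩
  sum (map (λ v → sumLists (suc n) N (λ ws → 𝟙 (suc n ≡ᵇ v) * f (v ∷ ws))) (values (suc n)))
    ≡⟨ sum-map-cong (λ v → sumLists-*ˡ (suc n) N (𝟙 (suc n ≡ᵇ v)) (f ∘ (v ∷_))) (values (suc n)) ⟩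
  sum (map (λ v → 𝟙 (suc n ≡ᵇ v) * sumLists (suc n) N (f ∘ (v ∷_))) (values (suc n)))
    ≡⟨ sum-values-at-max n (λ v → sumLists (suc n) N (f ∘ (v ∷_))) ⟩
  sumLists (suc n) N (f ∘ (suc n ∷_)) ∎
  where open ≡-Reasoning
sumLists-nth-max n (suc k) (suc N) f (s≤s k≤N) = begin
  sumLists (suc n) (suc (suc N)) (λ vs → 𝟙 (suc n ≡ᵇ nth 0 vs (suc k)) * f vs)
    ≡⟨ sumLists-suc (suc n) (suc N) _ ⟩
  sum (map (λ v → sumLists (suc n) (suc N) (λ ws → 𝟙 (suc n ≡ᵇ nth 0 ws k) * f (v ∷ ws))) (values (suc n)))
    ≡⟨ sum-map-cong (λ v → sumLists-nth-max n k N (f ∘ (v ∷_)) k≤N) (values (suc n)) ⟩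
  sum (map (λ v → sumLists (suc n) N (λ ws → f (v ∷ insertNth k (suc n) ws))) (values (suc n)))
    ≡⟨ sumLists-suc (suc n) N _ ⟨
  sumLists (suc n) (suc N) (f ∘ insertNth (suc k) (suc n)) ∎
  where open ≡-Reasoning

sumLists-avoiding-max : ∀ n N f → sumLists (suc n) N (λ ws → 𝟙 (not (elemᵇ (suc n) ws)) * f ws) ≡ sumLists n N f
sumLists-avoiding-max n zero f = cong (_+ 0) (*-identityˡ (f []))
sumLists-avoiding-max n (suc N) f = begin
  sumLists (suc n) (suc N) (λ ws → 𝟙 (not (elemᵇ (suc n) ws)) * f ws)
    ≡⟨ sumLists-suc (suc n) N _ ⟩
  sum (map (λ v → sumLists (suc n) N (λ ws → 𝟙 (not ((suc n ≡ᵇ v) ∨ elemᵇ (suc n) ws)) * f (v ∷ ws))) (values (suc n)))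
    ≡⟨ sum-map-cong (λ v → sum-map-cong (split v) (allLists (suc n) N)) (values (suc n)) ⟩
  sum (map (λ v → sumLists (suc n) N (λ ws → 𝟙 (not (suc n ≡ᵇ v)) * (𝟙 (not (elemᵇ (suc n) ws)) * f (v ∷ ws)))) (values (suc n)))
    ≡⟨ sum-map-cong recurse (values (suc n)) ⟩
  sum (map (λ v → 𝟙 (not (suc n ≡ᵇ v)) * sumLists n N (f ∘ (v ∷_))) (values (suc n)))
    ≡⟨ sum-values-below-max n _ ⟩
  sum (map (λ v → sumLists n N (f ∘ (v ∷_))) (values n))
    ≡⟨ sumLists-suc n N f ⟨
  sumLists n (suc N) f ∎
  where
  open ≡-Reasoning
  split : ∀ v ws → 𝟙 (not ((suc n ≡ᵇ v) ∨ elemᵇ (suc n) ws)) * f (v ∷ ws)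
                 ≡ 𝟙 (not (suc n ≡ᵇ v)) * (𝟙 (not (elemᵇ (suc n) ws)) * f (v ∷ ws))
  split v ws with suc n ≡ᵇ v
  ... | true = refl
  ... | false = sym (*-identityˡ _)
  recurse : ∀ v → sumLists (suc n) N (λ ws → 𝟙 (not (suc n ≡ᵇ v)) * (𝟙 (not (elemᵇ (suc n) ws)) * f (v ∷ ws)))
                ≡ 𝟙 (not (suc n ≡ᵇ v)) * sumLists n N (f ∘ (v ∷_))
  recurse v = trans (sumLists-*ˡ (suc n) N (𝟙 (not (suc n ≡ᵇ v))) _)
                    (cong (𝟙 (not (suc n ≡ᵇ v)) *_) (sumLists-avoiding-max n N (f ∘ (v ∷_))))

multiplicity : ℕ → List ℕ → ℕ
multiplicity x vs = sum (map (𝟙 ∘ (x ≡ᵇ_)) vs)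

Σ<-nth≡multiplicity : ∀ x vs → Σ< (length vs) (λ k → 𝟙 (x ≡ᵇ nth 0 vs k)) ≡ multiplicity x vs
Σ<-nth≡multiplicity x [] = refl
Σ<-nth≡multiplicity x (y ∷ ys) = cong (𝟙 (x ≡ᵇ y) +_) (Σ<-nth≡multiplicity x ys)

not-true⇒false : ∀ {b} → not b ≡ true → b ≡ false
not-true⇒false {false} _ = refl

∨-false⇒false : ∀ a b → a ∨ b ≡ false → a ≡ false × b ≡ false
∨-false⇒false a b e = ∨-conicalˡ a b e , ∨-conicalʳ a b e

∉⇒all-≢ᵇ : ∀ x vs → elemᵇ x vs ≡ false → All (λ y → (x ≡ᵇ y) ≡ false) vs
∉⇒all-≢ᵇ x [] _ = []
∉⇒all-≢ᵇ x (y ∷ ys) e with ∨-false⇒false (x ≡ᵇ y) (elemᵇ x ys) e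
... | x≢y , x∉ys = x≢y ∷ ∉⇒all-≢ᵇ x ys x∉ys

multiplicity-∉ : ∀ x vs → elemᵇ x vs ≡ false → multiplicity x vs ≡ 0
multiplicity-∉ x vs x∉vs = trans (sum-map-cong-local (All.map (cong 𝟙) (∉⇒all-≢ᵇ x vs x∉vs))) (sum-map-zero vs)

multiplicity-∈ : ∀ x vs → elemᵇ x vs ≡ true → 1 ≤ multiplicity x vs
multiplicity-∈ x (y ∷ ys) e with x ≡ᵇ y
... | true = s≤s z≤n
... | false = multiplicity-∈ x ys e

multiplicity-distinct : ∀ x vs → distinctᵇ vs ≡ true → multiplicity x vs ≤ 1
multiplicity-distinct x [] _ = z≤n
multiplicity-distinct x (y ∷ ys) d with x ≡ᵇ y in x≡y
... | false = multiplicity-distinct x ys (∧-conicalʳ _ _ d)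
... | true rewrite ≡ᵇ-true⇒≡ x y x≡y
                 | multiplicity-∉ y ys (not-true⇒false (∧-conicalˡ _ _ d)) = ≤-refl

filterᵇ : (ℕ → Bool) → List ℕ → List ℕ
filterᵇ p = filter (T? ∘ p)

length≡multiplicity+rest : ∀ x xs → length xs ≡ multiplicity x xs + length (filterᵇ (not ∘ (x ≡ᵇ_)) xs)
length≡multiplicity+rest x [] = refl
length≡multiplicity+rest x (y ∷ ys) with x ≡ᵇ y
... | true = cong suc (length≡multiplicity+rest x ys)
... | false = trans (cong suc (length≡multiplicity+rest x ys)) (sym (+-suc _ _))

filterᵇ-∉ : ∀ p z xs → elemᵇ z xs ≡ false → elemᵇ z (filterᵇ p xs) ≡ false
filterᵇ-∉ p z [] e = refl
filterᵇ-∉ p z (y ∷ ys) e with ∨-false⇒false (z ≡ᵇ y) (elemᵇ z ys) e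
... | z≢y , z∉ys with p y
... | true rewrite z≢y = filterᵇ-∉ p z ys z∉ys
... | false = filterᵇ-∉ p z ys z∉ys

filterᵇ-distinct : ∀ p xs → distinctᵇ xs ≡ true → distinctᵇ (filterᵇ p xs) ≡ true
filterᵇ-distinct p [] d = refl
filterᵇ-distinct p (y ∷ ys) d with p y
... | true rewrite filterᵇ-∉ p y ys (not-true⇒false (∧-conicalˡ _ _ d)) = filterᵇ-distinct p ys (∧-conicalʳ _ _ d)
... | false = filterᵇ-distinct p ys (∧-conicalʳ _ _ d)

filterᵇ-All : ∀ {P Q : ℕ → Set} p xs → All P xs → (∀ {y} → P y → p y ≡ true → Q y) → All Q (filterᵇ p xs)
filterᵇ-All p [] [] h = []
filterᵇ-All p (y ∷ ys) (py ∷ pys) h with p y in e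
... | true = h py e ∷ filterᵇ-All p ys pys h
... | false = filterᵇ-All p ys pys h

inRange-suc-≢ : ∀ {n y} → InRange (suc n) y → (suc n ≡ᵇ y) ≡ false → InRange n y
inRange-suc-≢ (1≤y , y≤1+n) 1+n≢y = 1≤y , ≤-pred (≤∧≢⇒< y≤1+n (≢-sym (≡ᵇ-false⇒≢ 1+n≢y)))

distinct⇒length≤ : ∀ n vs → distinctᵇ vs ≡ true → All (InRange n) vs → length vs ≤ n
distinct⇒length≤ zero [] _ _ = z≤n
distinct⇒length≤ zero (y ∷ ys) _ ((1≤y , y≤0) ∷ _) = ⊥-elim (1+n≰n (≤-trans 1≤y y≤0))
distinct⇒length≤ (suc n) vs d vs∈ = begin
  length vs                             ≡⟨ length≡multiplicity+rest (suc n) vs ⟩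
  multiplicity (suc n) vs + length rest ≤⟨ +-mono-≤ (multiplicity-distinct (suc n) vs d) rest≤n ⟩
  1 + n                                 ∎
  where
  open ≤-Reasoning
  rest = filterᵇ (not ∘ (suc n ≡ᵇ_)) vs
  rest≤n : length rest ≤ n
  rest≤n = distinct⇒length≤ n rest (filterᵇ-distinct _ vs d)
             (filterᵇ-All _ vs vs∈ (λ y∈ e → inRange-suc-≢ y∈ (not-true⇒false e)))

distinct-full⇒∋max : ∀ n vs → length vs ≡ suc n → distinctᵇ vs ≡ true → All (InRange (suc n)) vs →
  elemᵇ (suc n) vs ≡ true
distinct-full⇒∋max n vs len d vs∈ with elemᵇ (suc n) vs in e
... | true = refl
... | false = ⊥-elim (1+n≰n (subst (_≤ n) len (distinct⇒length≤ n vs d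
                (All.zipWith (λ (y∈ , 1+n≢y) → inRange-suc-≢ y∈ 1+n≢y) (vs∈ , ∉⇒all-≢ᵇ (suc n) vs e)))))

distinct-full⇒max-once : ∀ n vs → length vs ≡ suc n → distinctᵇ vs ≡ true → All (InRange (suc n)) vs →
  Σ< (suc n) (λ k → 𝟙 (suc n ≡ᵇ nth 0 vs k)) ≡ 1
distinct-full⇒max-once n vs len d vs∈ = begin
  Σ< (suc n) (λ k → 𝟙 (suc n ≡ᵇ nth 0 vs k))     ≡⟨ cong (λ l → Σ< l (λ k → 𝟙 (suc n ≡ᵇ nth 0 vs k))) len ⟨
  Σ< (length vs) (λ k → 𝟙 (suc n ≡ᵇ nth 0 vs k)) ≡⟨ Σ<-nth≡multiplicity (suc n) vs ⟩
  multiplicity (suc n) vs                        ≡⟨ ≤-antisym (multiplicity-distinct (suc n) vs d)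
                                                      (multiplicity-∈ (suc n) vs (distinct-full⇒∋max n vs len d vs∈)) ⟩
  1                                              ∎
  where open ≡-Reasoning

Cell : Set
Cell = ℕ × ℕ

isStandardᵇ : List Cell → List ℕ → Bool
isStandardᵇ P vs = distinctᵇ vs ∧ increasingᵇ (zip P vs)

countFillings : List Cell → ℕ
countFillings P = sumLists (length P) (length P) (𝟙 ∘ isStandardᵇ P)

noSuccessorIn : Cell → List Cell → Bool
noSuccessorIn c = all (λ d → not (adjᵇ c d))

isMaximalAt : List Cell → ℕ → Bool
isMaximalAt P k = noSuccessorIn (nth (0 , 0) P k) (deleteNth k P)

maximalTerm : List Cell → (List Cell → ℕ) → ℕ → ℕ
maximalTerm P F k = 𝟙 (isMaximalAt P k) * F (deleteNth k P)

sumMaximal : List Cell → (List Cell → ℕ) → ℕ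
sumMaximal P F = Σ< (length P) (maximalTerm P F)

-- The pair condition inside `increasingᵇ`, which therefore unfolds to all (λ p → all (orderedᵇ p) cf) cf.
orderedᵇ : Cell × ℕ → Cell × ℕ → Bool
orderedᵇ (c , a) (d , b) = not (adjᵇ c d) ∨ (a <ᵇ b)

all-insertNth : ∀ (p : A → Bool) k x xs → all p (insertNth k x xs) ≡ p x ∧ all p xs
all-insertNth p zero x xs = refl
all-insertNth p (suc k) x [] = refl
all-insertNth p (suc k) x (y ∷ xs) =
  trans (cong (p y ∧_) (all-insertNth p k x xs)) (∧.x∙yz≈y∙xz (p y) (p x) (all p xs))

elem-insertNth : ∀ z k x xs → elemᵇ z (insertNth k x xs) ≡ (z ≡ᵇ x) ∨ elemᵇ z xs
elem-insertNth z zero x xs = refl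
elem-insertNth z (suc k) x [] = refl
elem-insertNth z (suc k) x (y ∷ xs) =
  trans (cong ((z ≡ᵇ y) ∨_) (elem-insertNth z k x xs)) (∨.x∙yz≈y∙xz (z ≡ᵇ y) (z ≡ᵇ x) (elemᵇ z xs))

distinct-insertNth : ∀ k x ws → distinctᵇ (insertNth k x ws) ≡ not (elemᵇ x ws) ∧ distinctᵇ ws
distinct-insertNth zero x ws = refl
distinct-insertNth (suc k) x [] = refl
distinct-insertNth (suc k) x (w ∷ ws)
  rewrite elem-insertNth w k x ws | distinct-insertNth k x ws | ≡ᵇ-sym w x
  = shuffle (x ≡ᵇ w) (elemᵇ w ws) (elemᵇ x ws) (distinctᵇ ws)
  where
  shuffle : ∀ a b c d → not (a ∨ b) ∧ (not c ∧ d) ≡ not (a ∨ c) ∧ (not b ∧ d)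
  shuffle true b c d = refl
  shuffle false b c d = ∧.x∙yz≈y∙xz (not b) (not c) d

zip-insertNth : ∀ k (P : List Cell) (ws : List ℕ) x → suc (length ws) ≡ length P → k < length P →
  zip P (insertNth k x ws) ≡ insertNth k (nth (0 , 0) P k , x) (zip (deleteNth k P) ws)
zip-insertNth zero (c ∷ P) ws x _ _ = refl
zip-insertNth (suc k) (c ∷ []) [] x _ (s<s ())
zip-insertNth (suc k) (c ∷ d ∷ P) [] x () _
zip-insertNth (suc k) (c ∷ P) (w ∷ ws) x len (s<s k<n) =
  cong ((c , w) ∷_) (zip-insertNth k P ws x (suc-injective len) k<n)

adjᵇ-irrefl : ∀ c → adjᵇ c c ≡ false
adjᵇ-irrefl (i , j)
  rewrite ≢⇒≡ᵇ-false i (suc i) (<⇒≢ (n<1+n i)) | ≢⇒≡ᵇ-false j (suc j) (<⇒≢ (n<1+n j)) | ∧-zeroʳ (i ≡ᵇ i) = refl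

all-∧ : ∀ (p q : A → Bool) xs → all (λ a → p a ∧ q a) xs ≡ all p xs ∧ all q xs
all-∧ p q [] = refl
all-∧ p q (x ∷ xs) = trans (cong ((p x ∧ q x) ∧_) (all-∧ p q xs)) (∧.interchange (p x) (q x) (all p xs) (all q xs))

all-cong : ∀ {p q : A → Bool} → (∀ a → p a ≡ q a) → ∀ xs → all p xs ≡ all q xs
all-cong p≗q xs = cong (foldr _∧_ true) (map-cong p≗q xs)

increasing-insertNth : ∀ k x l → increasingᵇ (insertNth k x l)
  ≡ (orderedᵇ x x ∧ all (orderedᵇ x) l) ∧ (all (λ a → orderedᵇ a x) l ∧ increasingᵇ l)
increasing-insertNth k x l = begin
  all (λ p → all (orderedᵇ p) L) L
    ≡⟨ all-insertNth (λ p → all (orderedᵇ p) L) k x l ⟩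
  all (orderedᵇ x) L ∧ all (λ p → all (orderedᵇ p) L) l
    ≡⟨ cong₂ _∧_ (all-insertNth (orderedᵇ x) k x l) (all-cong (λ p → all-insertNth (orderedᵇ p) k x l) l) ⟩
  (orderedᵇ x x ∧ all (orderedᵇ x) l) ∧ all (λ p → orderedᵇ p x ∧ all (orderedᵇ p) l) l
    ≡⟨ cong ((orderedᵇ x x ∧ all (orderedᵇ x) l) ∧_) (all-∧ (λ p → orderedᵇ p x) (λ p → all (orderedᵇ p) l) l) ⟩
  (orderedᵇ x x ∧ all (orderedᵇ x) l) ∧ (all (λ a → orderedᵇ a x) l ∧ increasingᵇ l) ∎
  where
  open ≡-Reasoning
  L = insertNth k x l

all-ordered-from-max : ∀ c n (Q : List Cell) ws → length ws ≡ length Q → All (_≤ n) ws →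
  all (orderedᵇ (c , n)) (zip Q ws) ≡ noSuccessorIn c Q
all-ordered-from-max c n [] [] _ _ = refl
all-ordered-from-max c n (d ∷ Q) (b ∷ ws) len (b≤n ∷ ws≤n)
  rewrite ≤⇒<ᵇ-false b≤n | ∨-identityʳ (not (adjᵇ c d)) =
  cong (not (adjᵇ c d) ∧_) (all-ordered-from-max c n Q ws (suc-injective len) ws≤n)

all-ordered-to-max : ∀ c n (Q : List Cell) ws → All (_< n) ws → all (λ a → orderedᵇ a (c , n)) (zip Q ws) ≡ true
all-ordered-to-max c n [] ws _ = refl
all-ordered-to-max c n (d ∷ Q) [] _ = refl
all-ordered-to-max c n (d ∷ Q) (b ∷ ws) (b<n ∷ ws<n)
  rewrite <⇒<ᵇ-true b<n | ∨-zeroʳ (not (adjᵇ d c)) = all-ordered-to-max c n Q ws ws<n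

increasing-insertNth-max : ∀ k c n (Q : List Cell) ws → length ws ≡ length Q → All (_≤ n) ws →
  increasingᵇ (insertNth k (c , n) (zip Q ws))
  ≡ noSuccessorIn c Q ∧ (all (λ a → orderedᵇ a (c , n)) (zip Q ws) ∧ increasingᵇ (zip Q ws))
increasing-insertNth-max k c n Q ws len ws≤n = begin
  increasingᵇ (insertNth k x L)
    ≡⟨ increasing-insertNth k x L ⟩
  (orderedᵇ x x ∧ all (orderedᵇ x) L) ∧ (all (λ a → orderedᵇ a x) L ∧ increasingᵇ L)
    ≡⟨ cong₂ (λ self out → (self ∧ out) ∧ (all (λ a → orderedᵇ a x) L ∧ increasingᵇ L))
             (cong (λ b → not b ∨ (n <ᵇ n)) (adjᵇ-irrefl c)) (all-ordered-from-max c n Q ws len ws≤n) ⟩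
  noSuccessorIn c Q ∧ (all (λ a → orderedᵇ a x) L ∧ increasingᵇ L) ∎
  where
  open ≡-Reasoning
  x = (c , n)
  L = zip Q ws

isStandard-insertNth : ∀ P k n ws → suc (length ws) ≡ length P → k < length P → All (_≤ n) ws →
  isStandardᵇ P (insertNth k n ws) ≡ not (elemᵇ n ws) ∧ (isMaximalAt P k ∧ isStandardᵇ (deleteNth k P) ws)
isStandard-insertNth P k n ws len k<n ws≤n = begin
  distinctᵇ (insertNth k n ws) ∧ increasingᵇ (zip P (insertNth k n ws))
    ≡⟨ cong₂ _∧_ (distinct-insertNth k n ws) (cong increasingᵇ (zip-insertNth k P ws n len k<n)) ⟩
  (not (elemᵇ n ws) ∧ distinctᵇ ws) ∧ increasingᵇ (insertNth k (c , n) L)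
    ≡⟨ cong ((not (elemᵇ n ws) ∧ distinctᵇ ws) ∧_) (increasing-insertNth-max k c n Q ws lenQ ws≤n) ⟩
  (not (elemᵇ n ws) ∧ distinctᵇ ws) ∧ (isMaximalAt P k ∧ (all (λ a → orderedᵇ a (c , n)) L ∧ increasingᵇ L))
    ≡⟨ rearrange (elemᵇ n ws) (distinctᵇ ws) (isMaximalAt P k) _ (increasingᵇ L) below-max ⟩
  not (elemᵇ n ws) ∧ (isMaximalAt P k ∧ isStandardᵇ Q ws) ∎
  where
  open ≡-Reasoning
  c = nth (0 , 0) P k
  Q = deleteNth k P
  L = zip Q ws
  lenQ : length ws ≡ length Q
  lenQ = suc-injective (trans len (sym (length-deleteNth k P k<n)))
  below-max : elemᵇ n ws ≡ false → all (λ a → orderedᵇ a (c , n)) L ≡ true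
  below-max n∉ws = all-ordered-to-max c n Q ws
    (All.zipWith (λ (b≤n , n≢b) → ≤∧≢⇒< b≤n (≢-sym (≡ᵇ-false⇒≢ n≢b))) (ws≤n , ∉⇒all-≢ᵇ n ws n∉ws))
  rearrange : ∀ e d M A i → (e ≡ false → A ≡ true) → (not e ∧ d) ∧ (M ∧ (A ∧ i)) ≡ not e ∧ (M ∧ (d ∧ i))
  rearrange true d M A i _ = refl
  rearrange false d M A i A≡true rewrite A≡true refl = ∧.x∙yz≈y∙xz d M i

-- The largest value of a standard filling sits in a cell without successor.
countFillings-by-maximal-cell : ∀ P N → length P ≡ suc N → countFillings P ≡ sumMaximal P countFillings
countFillings-by-maximal-cell P N len = begin
  countFillings P
    ≡⟨ cong (λ l → sumLists l l (𝟙 ∘ isStandardᵇ P)) len ⟩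
  sumLists n n (𝟙 ∘ isStandardᵇ P)
    ≡⟨ sumLists-cong-local n n max-occurs-once ⟩
  sumLists n n (λ vs → Σ< n (λ k → 𝟙 (n ≡ᵇ nth 0 vs k) * 𝟙 (isStandardᵇ P vs)))
    ≡⟨ sum-map-Σ< n (λ k vs → 𝟙 (n ≡ᵇ nth 0 vs k) * 𝟙 (isStandardᵇ P vs)) (allLists n n) ⟩
  Σ< n (λ k → sumLists n n (λ vs → 𝟙 (n ≡ᵇ nth 0 vs k) * 𝟙 (isStandardᵇ P vs)))
    ≡⟨ Σ<-cong n (λ k k<n → sumLists-nth-max N k N (𝟙 ∘ isStandardᵇ P) (≤-pred k<n)) ⟩
  Σ< n (λ k → sumLists n N (λ ws → 𝟙 (isStandardᵇ P (insertNth k n ws))))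
    ≡⟨ Σ<-cong n (λ k k<n → sumLists-cong-local n N (remove-max k k<n)) ⟩
  Σ< n (λ k → sumLists n N (λ ws → 𝟙 (not (elemᵇ n ws)) * (𝟙 (isMaximalAt P k) * 𝟙 (isStandardᵇ (deleteNth k P) ws))))
    ≡⟨ Σ<-cong n (λ k _ → sumLists-avoiding-max N N (λ ws → 𝟙 (isMaximalAt P k) * 𝟙 (isStandardᵇ (deleteNth k P) ws))) ⟩
  Σ< n (λ k → sumLists N N (λ ws → 𝟙 (isMaximalAt P k) * 𝟙 (isStandardᵇ (deleteNth k P) ws)))
    ≡⟨ Σ<-cong n (λ k k<n → trans (sumLists-*ˡ N N (𝟙 (isMaximalAt P k)) _)
                                 (cong (λ l → 𝟙 (isMaximalAt P k) * sumLists l l (𝟙 ∘ isStandardᵇ (deleteNth k P)))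
                                       (length-deleted k k<n))) ⟩
  Σ< n (maximalTerm P countFillings)
    ≡⟨ cong (λ l → Σ< l (maximalTerm P countFillings)) len ⟨
  sumMaximal P countFillings ∎
  where
  open ≡-Reasoning
  n = suc N
  length-deleted : ∀ k → k < n → N ≡ length (deleteNth k P)
  length-deleted k k<n = sym (suc-injective (trans (length-deleteNth k P (subst (k <_) (sym len) k<n)) len))
  max-at : List ℕ → ℕ → ℕ
  max-at vs k = 𝟙 (n ≡ᵇ nth 0 vs k)
  max-occurs-once : ∀ vs → length vs ≡ n → All (InRange n) vs →
    𝟙 (isStandardᵇ P vs) ≡ Σ< n (λ k → 𝟙 (n ≡ᵇ nth 0 vs k) * 𝟙 (isStandardᵇ P vs))
  max-occurs-once vs lenvs vs∈ with isStandardᵇ P vs in std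
  ... | false = sym (trans (Σ<-*ʳ n (max-at vs) 0) (*-zeroʳ (Σ< n (max-at vs))))
  ... | true = sym (trans (Σ<-*ʳ n (max-at vs) 1) (trans (*-identityʳ (Σ< n (max-at vs)))
                 (distinct-full⇒max-once N vs lenvs (∧-conicalˡ _ _ std) vs∈)))
  remove-max : ∀ k → k < n → ∀ ws → length ws ≡ N → All (InRange n) ws →
    𝟙 (isStandardᵇ P (insertNth k n ws))
    ≡ 𝟙 (not (elemᵇ n ws)) * (𝟙 (isMaximalAt P k) * 𝟙 (isStandardᵇ (deleteNth k P) ws))
  remove-max k k<n ws lenws ws∈ = begin
    𝟙 (isStandardᵇ P (insertNth k n ws))
      ≡⟨ cong 𝟙 (isStandard-insertNth P k n ws (trans (cong suc lenws) (sym len)) (subst (k <_) (sym len) k<n)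
                                    (All.map proj₂ ws∈)) ⟩
    𝟙 (not (elemᵇ n ws) ∧ (isMaximalAt P k ∧ isStandardᵇ (deleteNth k P) ws))
      ≡⟨ 𝟙-∧ (not (elemᵇ n ws)) _ ⟩
    𝟙 (not (elemᵇ n ws)) * 𝟙 (isMaximalAt P k ∧ isStandardᵇ (deleteNth k P) ws)
      ≡⟨ cong (𝟙 (not (elemᵇ n ws)) *_) (𝟙-∧ (isMaximalAt P k) _) ⟩
    𝟙 (not (elemᵇ n ws)) * (𝟙 (isMaximalAt P k) * 𝟙 (isStandardᵇ (deleteNth k P) ws)) ∎

-- Strict partitions inside [m] as bit vectors

subsets : ℕ → List (List Bool)
subsets zero = [] ∷ []
subsets (suc m) = map (true ∷_) (subsets m) ++ map (false ∷_) (subsets m)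

-- The head of a vector of length r + 1 is the bit of the part r + 1.
parts : List Bool → List ℕ
parts [] = []
parts (true ∷ r) = suc (length r) ∷ parts r
parts (false ∷ r) = parts r

∁ : List Bool → List Bool
∁ = map not

size : List Bool → ℕ
size = sum ∘ parts

triangle : ℕ → ℕ
triangle zero = 0
triangle (suc n) = suc n + triangle n

-- A corner of λ is a part p with p - 1 ∉ λ; removing it lowers p by one (deleting it if p = 1).
removeHead : Bool → List Bool → List (List Bool)
removeHead true [] = (false ∷ []) ∷ []
removeHead true (false ∷ r) = (false ∷ true ∷ r) ∷ []
removeHead _ _ = []

removals : List Bool → List (List Bool)
removals [] = []
removals (b ∷ r) = removeHead b r ++ map (b ∷_) (removals r)

length-subsets : ∀ m → All (λ r → length r ≡ m) (subsets m)
length-subsets zero = refl ∷ []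
length-subsets (suc m) = ++⁺ (map⁺ (All.map (cong suc) (length-subsets m))) (map⁺ (All.map (cong suc) (length-subsets m)))

sum-subsets-suc : ∀ m (f : List Bool → ℕ) →
  sum (map f (subsets (suc m))) ≡ sum (map (f ∘ (true ∷_)) (subsets m)) + sum (map (f ∘ (false ∷_)) (subsets m))
sum-subsets-suc m f = trans (sum-map-++ f (map (true ∷_) (subsets m)) _)
  (cong₂ _+_ (sum-map-∘ f (true ∷_) (subsets m)) (sum-map-∘ f (false ∷_) (subsets m)))

∁-involutive : ∀ r → ∁ (∁ r) ≡ r
∁-involutive [] = refl
∁-involutive (b ∷ r) = cong₂ _∷_ (not-involutive b) (∁-involutive r)

length-∁ : ∀ r → length (∁ r) ≡ length r
length-∁ r = length-map not r

parts-≤-length : ∀ r → All (_≤ length r) (parts r)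
parts-≤-length [] = []
parts-≤-length (true ∷ r) = ≤-refl ∷ All.map m≤n⇒m≤1+n (parts-≤-length r)
parts-≤-length (false ∷ r) = All.map m≤n⇒m≤1+n (parts-≤-length r)

size+size-∁ : ∀ r → size r + size (∁ r) ≡ triangle (length r)
size+size-∁ [] = refl
size+size-∁ (true ∷ r) = trans (+-assoc (suc (length r)) (size r) _) (cong (suc (length r) +_) (size+size-∁ r))
size+size-∁ (false ∷ r) = begin
  size r + (suc (length (∁ r)) + size (∁ r)) ≡⟨ x∙yz≈y∙xz (size r) (suc (length (∁ r))) (size (∁ r)) ⟩
  suc (length (∁ r)) + (size r + size (∁ r)) ≡⟨ cong₂ (λ l s → suc l + s) (length-∁ r) (size+size-∁ r) ⟩
  triangle (length (false ∷ r))              ∎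
  where open ≡-Reasoning

removals-length-size : ∀ r → All (λ c → length c ≡ length r × suc (size c) ≡ size r) (removals r)
removals-length-size [] = []
removals-length-size (b ∷ r) = ++⁺ (head b r) (map⁺ (All.map (tail b) (removals-length-size r)))
  where
  head : ∀ b r → All (λ c → length c ≡ length (b ∷ r) × suc (size c) ≡ size (b ∷ r)) (removeHead b r)
  head true [] = (refl , refl) ∷ []
  head true (false ∷ r) = (refl , refl) ∷ []
  head true (true ∷ r) = []
  head false r = []
  tail : ∀ b {c} → length c ≡ length r × suc (size c) ≡ size r →
         length (b ∷ c) ≡ length (b ∷ r) × suc (size (b ∷ c)) ≡ size (b ∷ r)
  tail true {c} (len , sz) = cong suc len , trans (sym (+-suc (suc (length c)) (size c))) (cong₂ (λ l s → suc l + s) len sz)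
  tail false (len , sz) = cong suc len , sz

-- Maximal cells of a shifted diagram are its corners

nth-++ʳ : ∀ (d : A) xs ys k → nth d (xs ++ ys) (length xs + k) ≡ nth d ys k
nth-++ʳ d [] ys k = refl
nth-++ʳ d (x ∷ xs) ys k = nth-++ʳ d xs ys k

nth-++ˡ : ∀ (d : A) xs ys k → k < length xs → nth d (xs ++ ys) k ≡ nth d xs k
nth-++ˡ d (x ∷ xs) ys zero _ = refl
nth-++ˡ d (x ∷ xs) ys (suc k) (s<s k<n) = nth-++ˡ d xs ys k k<n

nth-applyUpTo : ∀ (d : A) f n k → k < n → nth d (applyUpTo f n) k ≡ f k
nth-applyUpTo d f (suc n) zero _ = refl
nth-applyUpTo d f (suc n) (suc k) (s<s k<n) = nth-applyUpTo d (f ∘ suc) n k k<n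

All⇒nth : ∀ {P : A → Set} (d : A) xs k → All P xs → k < length xs → P (nth d xs k)
All⇒nth d (x ∷ xs) zero (px ∷ _) _ = px
All⇒nth d (x ∷ xs) (suc k) (_ ∷ pxs) (s<s k<n) = All⇒nth d xs k pxs k<n

deleteNth-++ʳ : ∀ (xs ys : List A) k → deleteNth (length xs + k) (xs ++ ys) ≡ xs ++ deleteNth k ys
deleteNth-++ʳ [] ys k = refl
deleteNth-++ʳ (x ∷ xs) ys k = cong (x ∷_) (deleteNth-++ʳ xs ys k)

deleteNth-applyUpTo-last : ∀ (f : ℕ → A) n ys → deleteNth n (applyUpTo f (suc n) ++ ys) ≡ applyUpTo f n ++ ys
deleteNth-applyUpTo-last f zero ys = refl
deleteNth-applyUpTo-last f (suc n) ys = cong (f 0 ∷_) (deleteNth-applyUpTo-last (f ∘ suc) n ys)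

all-++ : ∀ (p : A → Bool) xs ys → all p (xs ++ ys) ≡ all p xs ∧ all p ys
all-++ p [] ys = refl
all-++ p (x ∷ xs) ys = trans (cong (p x ∧_) (all-++ p xs ys)) (sym (∧-assoc (p x) _ _))

All⇒all : ∀ (p : A → Bool) {xs} → All (λ x → p x ≡ true) xs → all p xs ≡ true
All⇒all p [] = refl
All⇒all p (px ∷ pxs) rewrite px = All⇒all p pxs

all-deleteNth-next : ∀ (p : A → Bool) d xs k → suc k < length xs → p (nth d xs (suc k)) ≡ false →
  all p (deleteNth k xs) ≡ false
all-deleteNth-next p d (x ∷ y ∷ xs) zero _ e rewrite e = refl
all-deleteNth-next p d (x ∷ xs) (suc k) (s<s k<n) e rewrite all-deleteNth-next p d xs k k<n e = ∧-zeroʳ (p x)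

all-applyUpTo-false : ∀ (p : A → Bool) f n k → k < n → p (f k) ≡ false → all p (applyUpTo f n) ≡ false
all-applyUpTo-false p f (suc n) zero _ e rewrite e = refl
all-applyUpTo-false p f (suc n) (suc k) (s<s k<n) e rewrite all-applyUpTo-false p (f ∘ suc) n k k<n e = ∧-zeroʳ (p (f 0))

adjᵇ-far-rows : ∀ c d → proj₁ d ≢ proj₁ c → proj₁ d ≢ suc (proj₁ c) → adjᵇ c d ≡ false
adjᵇ-far-rows (i , j) (i' , j') i'≢i i'≢1+i rewrite ≢⇒≡ᵇ-false i' i i'≢i | ≢⇒≡ᵇ-false i' (suc i) i'≢1+i = refl

adjᵇ-same-row : ∀ i j j' → j' ≢ suc j → adjᵇ (i , j) (i , j') ≡ false
adjᵇ-same-row i j j' j'≢1+j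
  rewrite ≢⇒≡ᵇ-false j' (suc j) j'≢1+j | ≢⇒≡ᵇ-false i (suc i) (<⇒≢ (n<1+n i)) | ∧-zeroʳ (i ≡ᵇ i) = refl

adjᵇ-right : ∀ i j → adjᵇ (i , j) (i , suc j) ≡ true
adjᵇ-right i j rewrite ≡ᵇ-refl i | ≡ᵇ-refl j = refl

adjᵇ-next-row : ∀ i j j' → j' ≢ j → adjᵇ (i , j) (suc i , j') ≡ false
adjᵇ-next-row i j j' j'≢j rewrite ≢⇒≡ᵇ-false (suc i) i (1+n≢n) | ≡ᵇ-refl i | ≢⇒≡ᵇ-false j' j j'≢j = refl

adjᵇ-below : ∀ i j → adjᵇ (i , j) (suc i , j) ≡ true
adjᵇ-below i j rewrite ≢⇒≡ᵇ-false (suc i) i (1+n≢n) | ≡ᵇ-refl i | ≡ᵇ-refl j = refl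

rowCells : ℕ → ℕ → List Cell
rowCells i p = applyUpTo (λ k → (i , i + k)) p

cellsFrom-∷ : ∀ i p ps → cellsFrom i (p ∷ ps) ≡ rowCells i p ++ cellsFrom (suc i) ps
cellsFrom-∷ i p ps = cong (_++ cellsFrom (suc i) ps) (map-upTo (λ k → (i , i + k)) p)

length-cellsFrom : ∀ i ps → length (cellsFrom i ps) ≡ sum ps
length-cellsFrom i [] = refl
length-cellsFrom i (p ∷ ps) = trans (cong length (cellsFrom-∷ i p ps))
  (trans (length-++ (rowCells i p)) (cong₂ _+_ (length-applyUpTo _ p) (length-cellsFrom (suc i) ps)))

cellsFrom-rows-≥ : ∀ i ps → All (λ c → i ≤ proj₁ c) (cellsFrom i ps)
cellsFrom-rows-≥ i [] = []
cellsFrom-rows-≥ i (p ∷ ps) = ++⁺ (map⁺ (All.tabulate (λ _ → ≤-refl)))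
  (All.map (≤-trans (n≤1+n i)) (cellsFrom-rows-≥ (suc i) ps))

lower-rows-noSuccessorIn-row : ∀ i p ps → All (λ c → noSuccessorIn c (rowCells i p) ≡ true) (cellsFrom (suc i) ps)
lower-rows-noSuccessorIn-row i p ps = All.map row-below (cellsFrom-rows-≥ (suc i) ps)
  where
  row-below : ∀ {c} → suc i ≤ proj₁ c → noSuccessorIn c (rowCells i p) ≡ true
  row-below {c} i<c = All⇒all _ (applyUpTo⁺₁ _ p (λ {k} _ → cong not (adjᵇ-far-rows c (i , i + k)
    (λ e → <-irrefl e i<c) (λ e → <-irrefl e (m≤n⇒m≤1+n i<c)))))

sumMaximal-++ : ∀ R Q (F : List Cell → ℕ) → All (λ c → noSuccessorIn c R ≡ true) Q →
  sumMaximal (R ++ Q) F ≡ Σ< (length R) (maximalTerm (R ++ Q) F) + sumMaximal Q (F ∘ (R ++_))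
sumMaximal-++ R Q F Q↛R = begin
  Σ< (length (R ++ Q)) term                                      ≡⟨ cong (λ l → Σ< l term) (length-++ R) ⟩
  Σ< (length R + length Q) term                                  ≡⟨ Σ<-+ (length R) (length Q) term ⟩
  Σ< (length R) term + Σ< (length Q) (λ k → term (length R + k)) ≡⟨ cong (Σ< (length R) term +_) (Σ<-cong (length Q) in-Q) ⟩
  Σ< (length R) term + sumMaximal Q (F ∘ (R ++_))               ∎
  where
  open ≡-Reasoning
  term = maximalTerm (R ++ Q) F
  in-Q : ∀ k → k < length Q → term (length R + k) ≡ maximalTerm Q (F ∘ (R ++_)) k
  in-Q k k<n = begin
    term (length R + k)
      ≡⟨ cong₂ (λ c X → 𝟙 (noSuccessorIn c X) * F X) (nth-++ʳ (0 , 0) R Q k) (deleteNth-++ʳ R Q k) ⟩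
    𝟙 (noSuccessorIn c (R ++ deleteNth k Q)) * F (R ++ deleteNth k Q)
      ≡⟨ cong (λ b → 𝟙 b * F (R ++ deleteNth k Q))
              (trans (all-++ _ R (deleteNth k Q)) (cong (_∧ isMaximalAt Q k) (All⇒nth (0 , 0) Q k Q↛R k<n))) ⟩
    maximalTerm Q (F ∘ (R ++_)) k ∎
    where c = nth (0 , 0) Q k

sumMaximal-row : ∀ i L (Q : List Cell) (F : List Cell → ℕ) →
  Σ< (suc L) (maximalTerm (rowCells i (suc L) ++ Q) F) ≡ 𝟙 (noSuccessorIn (i , i + L) Q) * F (rowCells i L ++ Q)
sumMaximal-row i L Q F = begin
  Σ< (suc L) term
    ≡⟨ Σ<-suc L term ⟩
  Σ< L term + term L
    ≡⟨ cong (_+ term L) (trans (Σ<-cong L inner-not-maximal) (Σ<-zero L)) ⟩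
  term L
    ≡⟨ cong₂ (λ c X → 𝟙 (noSuccessorIn c X) * F X) (nth-row L ≤-refl) (deleteNth-applyUpTo-last cell L Q) ⟩
  𝟙 (noSuccessorIn end (rowCells i L ++ Q)) * F (rowCells i L ++ Q)
    ≡⟨ cong (λ b → 𝟙 b * F (rowCells i L ++ Q))
            (trans (all-++ (λ d → not (adjᵇ end d)) (rowCells i L) Q) (cong (_∧ noSuccessorIn end Q) end-of-row)) ⟩
  𝟙 (noSuccessorIn end Q) * F (rowCells i L ++ Q) ∎
  where
  open ≡-Reasoning
  cell : ℕ → Cell
  cell j = (i , i + j)
  end = cell L
  row = rowCells i (suc L)
  P = row ++ Q
  term = maximalTerm P F
  k<row : ∀ {k} → k < suc L → k < length row
  k<row {k} = subst (k <_) (sym (length-applyUpTo cell (suc L)))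
  k<P : ∀ {k} → k < suc L → k < length P
  k<P {k} k<n = subst (k <_) (sym (length-++ row)) (≤-trans (k<row k<n) (m≤m+n (length row) (length Q)))
  nth-row : ∀ k → k < suc L → nth (0 , 0) P k ≡ cell k
  nth-row k k<n = trans (nth-++ˡ (0 , 0) row Q k (k<row k<n)) (nth-applyUpTo (0 , 0) cell (suc L) k k<n)
  inner-not-maximal : ∀ k → k < L → term k ≡ 0
  inner-not-maximal k k<L = cong (λ b → 𝟙 b * F (deleteNth k P))
    (all-deleteNth-next (λ d → not (adjᵇ (nth (0 , 0) P k) d)) (0 , 0) P k (k<P (s<s k<L)) (begin
      not (adjᵇ (nth (0 , 0) P k) (nth (0 , 0) P (suc k)))
        ≡⟨ cong₂ (λ c d → not (adjᵇ c d)) (nth-row k (m<n⇒m<1+n k<L)) (nth-row (suc k) (s<s k<L)) ⟩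
      not (adjᵇ (i , i + k) (i , i + suc k))    ≡⟨ cong (λ j → not (adjᵇ (i , i + k) (i , j))) (+-suc i k) ⟩
      not (adjᵇ (i , i + k) (i , suc (i + k)))  ≡⟨ cong not (adjᵇ-right i (i + k)) ⟩
      false                                      ∎))
  end-of-row : noSuccessorIn end (rowCells i L) ≡ true
  end-of-row = All⇒all (λ d → not (adjᵇ end d)) (applyUpTo⁺₁ cell L (λ {k} k<L → cong not
    (adjᵇ-same-row i (i + L) (i + k) (λ e → <-irrefl e (<-≤-trans (+-monoʳ-< i k<L) (n≤1+n (i + L)))))))

end-of-row-noSuccessor : ∀ i L ps → All (_< L) ps → noSuccessorIn (i , i + L) (cellsFrom (suc i) ps) ≡ true
end-of-row-noSuccessor i L [] _ = refl
end-of-row-noSuccessor i L (q ∷ ps) (q<L ∷ _) = begin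
  noSuccessorIn c (cellsFrom (suc i) (q ∷ ps))                   ≡⟨ cong (noSuccessorIn c) (cellsFrom-∷ (suc i) q ps) ⟩
  noSuccessorIn c (rowCells (suc i) q ++ lower)                  ≡⟨ all-++ (λ d → not (adjᵇ c d)) (rowCells (suc i) q) lower ⟩
  noSuccessorIn c (rowCells (suc i) q) ∧ noSuccessorIn c lower
    ≡⟨ cong₂ _∧_ (All⇒all (λ d → not (adjᵇ c d)) (applyUpTo⁺₁ (λ k → (suc i , suc i + k)) q next-row))
                 (All⇒all (λ d → not (adjᵇ c d)) (All.map (λ {d} → lower-rows {d}) (cellsFrom-rows-≥ (suc (suc i)) ps))) ⟩
  true                                                           ∎
  where
  open ≡-Reasoning
  c = (i , i + L)
  lower = cellsFrom (suc (suc i)) ps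
  next-row : ∀ {k} → k < q → not (adjᵇ c (suc i , suc i + k)) ≡ true
  next-row {k} k<q = cong not (adjᵇ-next-row i (i + L) (suc i + k)
    (λ e → <-irrefl (trans (+-suc i k) e) (+-monoʳ-< i (≤-<-trans k<q q<L))))
  lower-rows : ∀ {d} → suc (suc i) ≤ proj₁ d → not (adjᵇ c d) ≡ true
  lower-rows {d} i+2≤d = cong not (adjᵇ-far-rows c d (λ e → <-irrefl (sym e) (≤-trans (n≤1+n (suc i)) i+2≤d))
                                                      (λ e → <-irrefl (sym e) i+2≤d))

end-of-row-below : ∀ i L ps → noSuccessorIn (i , i + suc L) (cellsFrom (suc i) (suc L ∷ ps)) ≡ false
end-of-row-below i L ps = begin
  noSuccessorIn c (cellsFrom (suc i) (suc L ∷ ps))               ≡⟨ cong (noSuccessorIn c) (cellsFrom-∷ (suc i) (suc L) ps) ⟩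
  noSuccessorIn c (rowCells (suc i) (suc L) ++ lower)            ≡⟨ all-++ (λ d → not (adjᵇ c d)) (rowCells (suc i) (suc L)) lower ⟩
  noSuccessorIn c (rowCells (suc i) (suc L)) ∧ noSuccessorIn c lower
    ≡⟨ cong (_∧ noSuccessorIn c lower)
            (all-applyUpTo-false (λ d → not (adjᵇ c d)) (λ k → (suc i , suc i + k)) (suc L) L ≤-refl below) ⟩
  false                                                          ∎
  where
  open ≡-Reasoning
  c = (i , i + suc L)
  lower = cellsFrom (suc (suc i)) ps
  below : not (adjᵇ c (suc i , suc i + L)) ≡ false
  below = trans (cong (λ j → not (adjᵇ (i , j) (suc i , suc (i + L)))) (+-suc i L)) (cong not (adjᵇ-below i (suc (i + L))))

sum-removeHead-cells : ∀ i r (F : List Cell → ℕ) →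
  sum (map (λ c → F (cellsFrom i (parts c))) (removeHead true r))
  ≡ 𝟙 (noSuccessorIn (i , i + length r) (cellsFrom (suc i) (parts r))) * F (rowCells i (length r) ++ cellsFrom (suc i) (parts r))
sum-removeHead-cells i [] F = trans (+-identityʳ (F [])) (sym (*-identityˡ (F [])))
sum-removeHead-cells i (false ∷ r) F = begin
  F (cellsFrom i (L ∷ parts r)) + 0     ≡⟨ +-identityʳ _ ⟩
  F (cellsFrom i (L ∷ parts r))         ≡⟨ cong F (cellsFrom-∷ i L (parts r)) ⟩
  F (rowCells i L ++ Q)                 ≡⟨ *-identityˡ _ ⟨
  1 * F (rowCells i L ++ Q)             ≡⟨ cong (λ b → 𝟙 b * F (rowCells i L ++ Q)) end-of-row ⟨
  𝟙 (noSuccessorIn (i , i + L) Q) * F (rowCells i L ++ Q) ∎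
  where
  open ≡-Reasoning
  L = suc (length r)
  Q = cellsFrom (suc i) (parts r)
  end-of-row : noSuccessorIn (i , i + L) Q ≡ true
  end-of-row = end-of-row-noSuccessor i L (parts r) (All.map s≤s (parts-≤-length r))
sum-removeHead-cells i (true ∷ r) F =
  cong (λ b → 𝟙 b * F (rowCells i (suc (length r)) ++ cellsFrom (suc i) (parts (true ∷ r))))
       (sym (end-of-row-below i (length r) (parts r)))

sumMaximal≡sum-removals : ∀ i bs (F : List Cell → ℕ) →
  sumMaximal (cellsFrom i (parts bs)) F ≡ sum (map (λ c → F (cellsFrom i (parts c))) (removals bs))
sumMaximal≡sum-removals i [] F = refl
sumMaximal≡sum-removals i (false ∷ r) F =
  trans (sumMaximal≡sum-removals i r F) (sym (sum-map-∘ _ (false ∷_) (removals r)))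
sumMaximal≡sum-removals i (true ∷ r) F = begin
  sumMaximal (cellsFrom i (suc L ∷ parts r)) F
    ≡⟨ cong (λ X → sumMaximal X F) (cellsFrom-∷ i (suc L) (parts r)) ⟩
  sumMaximal (row ++ Q) F
    ≡⟨ sumMaximal-++ row Q F (lower-rows-noSuccessorIn-row i (suc L) (parts r)) ⟩
  Σ< (length row) (maximalTerm (row ++ Q) F) + sumMaximal Q (F ∘ (row ++_))
    ≡⟨ cong₂ _+_ (trans (cong (λ l → Σ< l (maximalTerm (row ++ Q) F)) (length-applyUpTo (λ k → (i , i + k)) (suc L)))
                        (sumMaximal-row i L Q F))
                 (sumMaximal≡sum-removals (suc i) r (F ∘ (row ++_))) ⟩
  𝟙 (noSuccessorIn (i , i + L) Q) * F (rowCells i L ++ Q) + sum (map (λ c → F (row ++ cellsFrom (suc i) (parts c))) (removals r))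
    ≡⟨ cong₂ _+_ (sym (sum-removeHead-cells i r F))
                 (sum-map-cong-local (All.map (λ {c} → tail-row {c}) (removals-length-size r))) ⟩
  sum (map F′ (removeHead true r)) + sum (map (F′ ∘ (true ∷_)) (removals r))
    ≡⟨ cong (sum (map F′ (removeHead true r)) +_) (sum-map-∘ F′ (true ∷_) (removals r)) ⟨
  sum (map F′ (removeHead true r)) + sum (map F′ (map (true ∷_) (removals r)))
    ≡⟨ sum-map-++ F′ (removeHead true r) _ ⟨
  sum (map F′ (removals (true ∷ r))) ∎
  where
  open ≡-Reasoning
  L = length r
  row = rowCells i (suc L)
  Q = cellsFrom (suc i) (parts r)
  F′ : List Bool → ℕ
  F′ c = F (cellsFrom i (parts c))
  tail-row : ∀ {c} → length c ≡ L × suc (size c) ≡ size r → F (row ++ cellsFrom (suc i) (parts c)) ≡ F′ (true ∷ c)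
  tail-row {c} (len , _) = cong (λ X → F (X ++ cellsFrom (suc i) (parts c)))
    (trans (cong (rowCells i ∘ suc) (sym len)) (sym (map-upTo (λ k → (i , i + k)) (suc (length c)))))

gᵇ : List Bool → ℕ
gᵇ = g ∘ parts

g≡countFillings : ∀ lam → g lam ≡ countFillings (cells lam)
g≡countFillings lam = trans (length-filterᵇ (isShiftedSYTᵇ lam) (allLists (sum lam) (length (cells lam))))
  (cong (λ n → sumLists n (length (cells lam)) (𝟙 ∘ isStandardᵇ (cells lam))) (sym (length-cellsFrom 1 lam)))

gᵇ-removals : ∀ bs → 0 < size bs → gᵇ bs ≡ sum (map gᵇ (removals bs))
gᵇ-removals bs 0<size = begin
  g (parts bs)                                            ≡⟨ g≡countFillings (parts bs) ⟩
  countFillings P                                         ≡⟨ countFillings-by-maximal-cell P N lenP ⟩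
  sumMaximal P countFillings                              ≡⟨ sumMaximal≡sum-removals 1 bs countFillings ⟩
  sum (map (countFillings ∘ cells ∘ parts) (removals bs)) ≡⟨ sum-map-cong (sym ∘ g≡countFillings ∘ parts) (removals bs) ⟩
  sum (map gᵇ (removals bs))                              ∎
  where
  open ≡-Reasoning
  P = cells (parts bs)
  N = pred (size bs)
  lenP : length P ≡ suc N
  lenP = trans (length-cellsFrom 1 (parts bs)) (sym (suc-pred (size bs) {{>-nonZero 0<size}}))

-- Complementation exchanges removing and adding a corner

sumRemovals : ℕ → (List Bool → List Bool → ℕ) → ℕ
sumRemovals m Φ = sum (map (λ x → sum (map (Φ x) (removals x))) (subsets m))

sumAdditions : ℕ → (List Bool → List Bool → ℕ) → ℕ
sumAdditions m Φ = sum (map (λ y → sum (map (λ c → Φ (∁ c) y) (removals (∁ y)))) (subsets m))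

headRemovals : ℕ → (List Bool → List Bool → ℕ) → ℕ
headRemovals m Φ = sum (map (λ r → sum (map (Φ (true ∷ r)) (removeHead true r))) (subsets m))

headAdditions : ℕ → (List Bool → List Bool → ℕ) → ℕ
headAdditions m Φ = sum (map (λ r → sum (map (λ c → Φ (∁ c) (false ∷ r)) (removeHead true (∁ r)))) (subsets m))

under : Bool → (List Bool → List Bool → ℕ) → List Bool → List Bool → ℕ
under b Φ x y = Φ (b ∷ x) (b ∷ y)

sumRemovals-suc : ∀ m Φ →
  sumRemovals (suc m) Φ ≡ headRemovals m Φ + (sumRemovals m (under true Φ) + sumRemovals m (under false Φ))
sumRemovals-suc m Φ = begin
  sumRemovals (suc m) Φ
    ≡⟨ sum-subsets-suc m R ⟩
  sum (map (R ∘ (true ∷_)) S) + sum (map (R ∘ (false ∷_)) S)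
    ≡⟨ cong₂ _+_ (trans (sum-map-cong (split true) S) (sum-map-+ _ _ S)) (sum-map-cong (split false) S) ⟩
  (headRemovals m Φ + sumRemovals m (under true Φ)) + sumRemovals m (under false Φ)
    ≡⟨ +-assoc (headRemovals m Φ) _ _ ⟩
  headRemovals m Φ + (sumRemovals m (under true Φ) + sumRemovals m (under false Φ)) ∎
  where
  open ≡-Reasoning
  S = subsets m
  R : List Bool → ℕ
  R x = sum (map (Φ x) (removals x))
  split : ∀ b r → R (b ∷ r) ≡ sum (map (Φ (b ∷ r)) (removeHead b r)) + sum (map (under b Φ r) (removals r))
  split b r = trans (sum-map-++ (Φ (b ∷ r)) (removeHead b r) _)
                    (cong (sum (map (Φ (b ∷ r)) (removeHead b r)) +_) (sum-map-∘ (Φ (b ∷ r)) (b ∷_) (removals r)))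

sumAdditions-suc : ∀ m Φ →
  sumAdditions (suc m) Φ ≡ headAdditions m Φ + (sumAdditions m (under true Φ) + sumAdditions m (under false Φ))
sumAdditions-suc m Φ = begin
  sumAdditions (suc m) Φ
    ≡⟨ sum-subsets-suc m Add ⟩
  sum (map (Add ∘ (true ∷_)) S) + sum (map (Add ∘ (false ∷_)) S)
    ≡⟨ cong₂ _+_ (sum-map-cong (split true) S) (trans (sum-map-cong (split false) S) (sum-map-+ _ _ S)) ⟩
  sumAdditions m (under true Φ) + (headAdditions m Φ + sumAdditions m (under false Φ))
    ≡⟨ x∙yz≈y∙xz (sumAdditions m (under true Φ)) (headAdditions m Φ) (sumAdditions m (under false Φ)) ⟩
  headAdditions m Φ + (sumAdditions m (under true Φ) + sumAdditions m (under false Φ)) ∎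
  where
  open ≡-Reasoning
  S = subsets m
  Add : List Bool → ℕ
  Add y = sum (map (λ c → Φ (∁ c) y) (removals (∁ y)))
  split : ∀ b r → Add (b ∷ r) ≡ sum (map (λ c → Φ (∁ c) (b ∷ r)) (removeHead (not b) (∁ r)))
                            + sum (map (λ c → Φ (not (not b) ∷ ∁ c) (b ∷ r)) (removals (∁ r)))
  split b r = trans (sum-map-++ (λ c → Φ (∁ c) (b ∷ r)) (removeHead (not b) (∁ r)) _)
                    (cong (sum (map (λ c → Φ (∁ c) (b ∷ r)) (removeHead (not b) (∁ r))) +_)
                          (sum-map-∘ (λ c → Φ (∁ c) (b ∷ r)) (not b ∷_) (removals (∁ r))))

headRemovals≡headAdditions : ∀ m Φ → headRemovals m Φ ≡ headAdditions m Φ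
headRemovals≡headAdditions zero Φ = refl
headRemovals≡headAdditions (suc m) Φ = begin
  headRemovals (suc m) Φ                ≡⟨ sum-subsets-suc m _ ⟩
  sum (map (λ _ → 0) S) + sum (map before S) ≡⟨ cong₂ _+_ (sum-map-zero S) (sum-map-cong head≗ S) ⟩
  0 + sum (map after S)                    ≡⟨ +-comm 0 (sum (map after S)) ⟩
  sum (map after S) + 0                    ≡⟨ cong (sum (map after S) +_) (sum-map-zero S) ⟨
  sum (map after S) + sum (map (λ _ → 0) S) ≡⟨ sum-subsets-suc m _ ⟨
  headAdditions (suc m) Φ               ∎
  where
  open ≡-Reasoning
  S = subsets m
  before after : List Bool → ℕ
  before s = Φ (true ∷ false ∷ s) (false ∷ true ∷ s) + 0
  after s = Φ (true ∷ false ∷ ∁ (∁ s)) (false ∷ true ∷ s) + 0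
  head≗ : ∀ s → before s ≡ after s
  head≗ s = cong (λ z → Φ (true ∷ false ∷ z) (false ∷ true ∷ s) + 0) (sym (∁-involutive s))

sumRemovals≡sumAdditions : ∀ m Φ → sumRemovals m Φ ≡ sumAdditions m Φ
sumRemovals≡sumAdditions zero Φ = refl
sumRemovals≡sumAdditions (suc m) Φ = begin
  sumRemovals (suc m) Φ
    ≡⟨ sumRemovals-suc m Φ ⟩
  headRemovals m Φ + (sumRemovals m (under true Φ) + sumRemovals m (under false Φ))
    ≡⟨ cong₂ _+_ (headRemovals≡headAdditions m Φ)
                 (cong₂ _+_ (sumRemovals≡sumAdditions m (under true Φ)) (sumRemovals≡sumAdditions m (under false Φ))) ⟩
  headAdditions m Φ + (sumAdditions m (under true Φ) + sumAdditions m (under false Φ))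
    ≡⟨ sumAdditions-suc m Φ ⟨
  sumAdditions (suc m) Φ ∎
  where open ≡-Reasoning

𝟙*-cong : ∀ b {u v} → (b ≡ true → u ≡ v) → 𝟙 b * u ≡ 𝟙 b * v
𝟙*-cong false _ = refl
𝟙*-cong true u≡v = cong (1 *_) (u≡v refl)

0<size-∁ : ∀ y → size y < triangle (length y) → 0 < size (∁ y)
0<size-∁ y lt = +-cancelˡ-< (size y) 0 (size (∁ y)) (subst₂ _<_ (sym (+-identityʳ (size y))) (sym (size+size-∁ y)) lt)

size-∁-removal-∁ : ∀ y c → length c ≡ length (∁ y) × suc (size c) ≡ size (∁ y) → size (∁ c) ≡ suc (size y)
size-∁-removal-∁ y c (len , sz) = +-cancelʳ-≡ (size c) _ _ (begin
  size (∁ c) + size c           ≡⟨ +-comm (size (∁ c)) (size c) ⟩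
  size c + size (∁ c)           ≡⟨ size+size-∁ c ⟩
  triangle (length c)           ≡⟨ cong triangle (trans len (length-∁ y)) ⟩
  triangle (length y)           ≡⟨ size+size-∁ y ⟨
  size y + size (∁ y)           ≡⟨ cong (size y +_) sz ⟨
  size y + suc (size c)         ≡⟨ +-suc (size y) (size c) ⟩
  suc (size y) + size c         ∎)
  where open ≡-Reasoning

pairSum : ℕ → ℕ → ℕ
pairSum m t = sum (map (λ x → 𝟙 (size x ≡ᵇ t) * (gᵇ x * gᵇ (∁ x))) (subsets m))

pairSum-suc : ∀ m t → suc t ≤ triangle m → pairSum m (suc t) ≡ pairSum m t
pairSum-suc m t t<max = begin
  pairSum m (suc t)   ≡⟨ sum-map-cong expand (subsets m) ⟩
  sumRemovals m Φ     ≡⟨ sumRemovals≡sumAdditions m Φ ⟩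
  sumAdditions m Φ    ≡⟨ sum-map-cong-local (All.map (λ {y} → contract y) (length-subsets m)) ⟩
  pairSum m t         ∎
  where
  open ≡-Reasoning
  Φ : List Bool → List Bool → ℕ
  Φ x y = 𝟙 (size x ≡ᵇ suc t) * (gᵇ y * gᵇ (∁ x))
  expand : ∀ x → 𝟙 (size x ≡ᵇ suc t) * (gᵇ x * gᵇ (∁ x)) ≡ sum (map (Φ x) (removals x))
  expand x = begin
    𝟙 (size x ≡ᵇ suc t) * (gᵇ x * gᵇ (∁ x))
      ≡⟨ 𝟙*-cong (size x ≡ᵇ suc t) (λ e → cong (_* gᵇ (∁ x))
           (gᵇ-removals x (subst (0 <_) (sym (≡ᵇ-true⇒≡ (size x) (suc t) e)) z<s))) ⟩
    𝟙 (size x ≡ᵇ suc t) * (sum (map gᵇ (removals x)) * gᵇ (∁ x))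
      ≡⟨ cong (𝟙 (size x ≡ᵇ suc t) *_) (sum-map-*ʳ (gᵇ (∁ x)) gᵇ (removals x)) ⟨
    𝟙 (size x ≡ᵇ suc t) * sum (map (λ y → gᵇ y * gᵇ (∁ x)) (removals x))
      ≡⟨ sum-map-*ˡ (𝟙 (size x ≡ᵇ suc t)) _ (removals x) ⟨
    sum (map (Φ x) (removals x)) ∎
  contract : ∀ y → length y ≡ m →
    sum (map (λ c → Φ (∁ c) y) (removals (∁ y))) ≡ 𝟙 (size y ≡ᵇ t) * (gᵇ y * gᵇ (∁ y))
  contract y len = begin
    sum (map (λ c → Φ (∁ c) y) (removals (∁ y)))
      ≡⟨ sum-map-cong-local (All.map (λ {c} p → cong₂ (λ s z → 𝟙 (s ≡ᵇ suc t) * (gᵇ y * gᵇ z))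
                                        (size-∁-removal-∁ y c p) (∁-involutive c))
                                     (removals-length-size (∁ y))) ⟩
    sum (map (λ c → 𝟙 (size y ≡ᵇ t) * (gᵇ y * gᵇ c)) (removals (∁ y)))
      ≡⟨ sum-map-*ˡ (𝟙 (size y ≡ᵇ t)) _ (removals (∁ y)) ⟩
    𝟙 (size y ≡ᵇ t) * sum (map (λ c → gᵇ y * gᵇ c) (removals (∁ y)))
      ≡⟨ cong (𝟙 (size y ≡ᵇ t) *_) (sum-map-*ˡ (gᵇ y) gᵇ (removals (∁ y))) ⟩
    𝟙 (size y ≡ᵇ t) * (gᵇ y * sum (map gᵇ (removals (∁ y))))
      ≡⟨ 𝟙*-cong (size y ≡ᵇ t) (λ e → cong (gᵇ y *_) (sym (gᵇ-removals (∁ y) (0<size-∁ y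
           (subst₂ (λ s l → suc s ≤ triangle l) (sym (≡ᵇ-true⇒≡ (size y) t e)) (sym len) t<max))))) ⟩
    𝟙 (size y ≡ᵇ t) * (gᵇ y * gᵇ (∁ y)) ∎

pairSum-independent : ∀ m t → t ≤ triangle m → pairSum m t ≡ pairSum m 0
pairSum-independent m zero _ = refl
pairSum-independent m (suc t) t<max = trans (pairSum-suc m t t<max) (pairSum-independent m t (<⇒≤ t<max))

sum-subsets-size-zero : ∀ m (h : List Bool → ℕ) →
  sum (map (λ x → 𝟙 (size x ≡ᵇ 0) * h x) (subsets m)) ≡ h (replicate m false)
sum-subsets-size-zero zero h = trans (+-identityʳ (1 * h [])) (*-identityˡ (h []))
sum-subsets-size-zero (suc m) h = begin
  sum (map (λ x → 𝟙 (size x ≡ᵇ 0) * h x) (subsets (suc m)))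
    ≡⟨ sum-subsets-suc m _ ⟩
  sum (map (λ _ → 0) (subsets m)) + sum (map (λ x → 𝟙 (size x ≡ᵇ 0) * h (false ∷ x)) (subsets m))
    ≡⟨ cong (_+ sum (map (λ x → 𝟙 (size x ≡ᵇ 0) * h (false ∷ x)) (subsets m))) (sum-map-zero (subsets m)) ⟩
  sum (map (λ x → 𝟙 (size x ≡ᵇ 0) * h (false ∷ x)) (subsets m))
    ≡⟨ sum-subsets-size-zero m (h ∘ (false ∷_)) ⟩
  h (replicate (suc m) false) ∎
  where open ≡-Reasoning

filterᵇ-accept : ∀ (p : ℕ → Bool) x xs → p x ≡ true → filterᵇ p (x ∷ xs) ≡ x ∷ filterᵇ p xs
filterᵇ-accept p x xs e rewrite e = refl

filterᵇ-reject : ∀ (p : ℕ → Bool) x xs → p x ≡ false → filterᵇ p (x ∷ xs) ≡ filterᵇ p xs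
filterᵇ-reject p x xs e rewrite e = refl

filterᵇ-cong-local : ∀ (p q : ℕ → Bool) {xs} → All (λ x → p x ≡ q x) xs → filterᵇ p xs ≡ filterᵇ q xs
filterᵇ-cong-local p q [] = refl
filterᵇ-cong-local p q {x ∷ xs} (px≡qx ∷ eqs) with q x
... | true = trans (filterᵇ-accept p x xs px≡qx) (cong (x ∷_) (filterᵇ-cong-local p q eqs))
... | false = trans (filterᵇ-reject p x xs px≡qx) (filterᵇ-cong-local p q eqs)

∉-above : ∀ x ys → All (_< x) ys → elemᵇ x ys ≡ false
∉-above x [] [] = refl
∉-above x (y ∷ ys) (y<x ∷ ys<x) rewrite ≢⇒≡ᵇ-false x y (≢-sym (<⇒≢ y<x)) = ∉-above x ys ys<x

stair-≤ : ∀ n → All (_≤ n) (stair n)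
stair-≤ zero = []
stair-≤ (suc n) = ≤-refl ∷ All.map m≤n⇒m≤1+n (stair-≤ n)

compl-parts : ∀ r → compl (length r) (parts r) ≡ parts (∁ r)
compl-parts [] = refl
compl-parts (true ∷ r) = begin
  filterᵇ (λ y → not (elemᵇ y (suc n ∷ parts r))) (suc n ∷ stair n)
    ≡⟨ filterᵇ-reject (λ y → not (elemᵇ y (suc n ∷ parts r))) (suc n) (stair n)
         (cong (λ b → not (b ∨ elemᵇ (suc n) (parts r))) (≡ᵇ-refl n)) ⟩
  filterᵇ (λ y → not (elemᵇ y (suc n ∷ parts r))) (stair n)
    ≡⟨ filterᵇ-cong-local _ _ (All.map (λ {y} y≤n → cong (λ b → not (b ∨ elemᵇ y (parts r)))
                                         (≢⇒≡ᵇ-false y (suc n) (λ e → 1+n≰n (subst (_≤ n) e y≤n)))) (stair-≤ n)) ⟩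
  compl n (parts r)
    ≡⟨ compl-parts r ⟩
  parts (∁ r) ∎
  where
  open ≡-Reasoning
  n = length r
compl-parts (false ∷ r) = begin
  filterᵇ (λ y → not (elemᵇ y (parts r))) (suc n ∷ stair n)
    ≡⟨ filterᵇ-accept (λ y → not (elemᵇ y (parts r))) (suc n) (stair n)
                      (cong not (∉-above (suc n) (parts r) (All.map s≤s (parts-≤-length r)))) ⟩
  suc n ∷ compl n (parts r)
    ≡⟨ cong₂ (λ l ps → suc l ∷ ps) (sym (length-∁ r)) (compl-parts r) ⟩
  parts (∁ (false ∷ r)) ∎
  where
  open ≡-Reasoning
  n = length r

sublists-stair : ∀ m → sublists (stair m) ≡ map parts (subsets m)
sublists-stair zero = refl
sublists-stair (suc m) = begin
  map (suc m ∷_) (sublists (stair m)) ++ sublists (stair m)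
    ≡⟨ cong (λ ps → map (suc m ∷_) ps ++ ps) (sublists-stair m) ⟩
  map (suc m ∷_) (map parts S) ++ map parts S
    ≡⟨ cong₂ _++_ (trans (sym (map-∘ S)) (trans (map-cong-local (All.map (λ len → cong (λ l → suc l ∷ _) (sym len))
                                                                          (length-subsets m)))
                                               (map-∘ S)))
                  (map-∘ S) ⟩
  map parts (map (true ∷_) S) ++ map parts (map (false ∷_) S)
    ≡⟨ map-++ parts (map (true ∷_) S) _ ⟨
  map parts (subsets (suc m)) ∎
  where
  open ≡-Reasoning
  S = subsets m

sum-lhs≡pairSum : ∀ m t → sum (lhs m t) ≡ pairSum m t
sum-lhs≡pairSum m t = begin
  sum (map term (sublists (stair m)))    ≡⟨ cong (sum ∘ map term) (sublists-stair m) ⟩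
  sum (map term (map parts (subsets m))) ≡⟨ sum-map-∘ term parts (subsets m) ⟩
  sum (map (term ∘ parts) (subsets m))   ≡⟨ sum-map-cong-local (All.map (λ {x} → term-parts x) (length-subsets m)) ⟩
  pairSum m t                            ∎
  where
  open ≡-Reasoning
  term : List ℕ → ℕ
  term lam = if sum lam ≡ᵇ t then g lam * g (compl m lam) else 0
  term-parts : ∀ x → length x ≡ m → term (parts x) ≡ 𝟙 (size x ≡ᵇ t) * (gᵇ x * gᵇ (∁ x))
  term-parts x len = trans (if-then-0≡𝟙* (size x ≡ᵇ t) _)
    (cong (λ lam → 𝟙 (size x ≡ᵇ t) * (gᵇ x * g lam)) (trans (cong (λ l → compl l (parts x)) (sym len)) (compl-parts x)))

pairSum-zero : ∀ m → pairSum m 0 ≡ g (stair m)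
pairSum-zero m = begin
  pairSum m 0                                              ≡⟨ sum-subsets-size-zero m (λ x → gᵇ x * gᵇ (∁ x)) ⟩
  gᵇ (replicate m false) * gᵇ (∁ (replicate m false))      ≡⟨ cong₂ _*_ (cong g (parts-none m)) (cong gᵇ (∁-none m)) ⟩
  1 * gᵇ (replicate m true)                                ≡⟨ *-identityˡ _ ⟩
  g (parts (replicate m true))                             ≡⟨ cong g (stair≡parts-all m) ⟨
  g (stair m)                                              ∎
  where
  open ≡-Reasoning
  parts-none : ∀ m → parts (replicate m false) ≡ []
  parts-none zero = refl
  parts-none (suc m) = parts-none m
  ∁-none : ∀ m → ∁ (replicate m false) ≡ replicate m true
  ∁-none zero = refl
  ∁-none (suc m) = cong (true ∷_) (∁-none m)
  stair≡parts-all : ∀ m → stair m ≡ parts (replicate m true)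
  stair≡parts-all zero = refl
  stair≡parts-all (suc m) = cong₂ _∷_ (cong suc (sym (length-replicate m))) (stair≡parts-all m)

[1+m]C2≡triangle : ∀ m → suc m C 2 ≡ triangle m
[1+m]C2≡triangle zero = refl
[1+m]C2≡triangle (suc m) = trans (sym (nCk+nC[k+1]≡[n+1]C[k+1] (suc m) 1)) (cong₂ _+_ (nC1≡n (suc m)) ([1+m]C2≡triangle m))

corollary4p3 : (m t : ℕ) → t ≤ suc m C 2 → sum (lhs m t) ≡ g (stair m)
corollary4p3 m t t≤max = begin
  sum (lhs m t) ≡⟨ sum-lhs≡pairSum m t ⟩
  pairSum m t   ≡⟨ pairSum-independent m t (subst (t ≤_) ([1+m]C2≡triangle m) t≤max) ⟩
  pairSum m 0   ≡⟨ pairSum-zero m ⟩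
  g (stair m)   ∎
  where open ≡-Reasoning
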